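{- Let $G_0,G_1\in\mathbb{Z}$ with $\gcd(G_0,G_1)=1$, and let $(G_n)_{n\ge0}$ satisfy $G_n=G_{n-1}+G_{n-2}$ for $n\ge2$. If $k$ is a positive integer with $k\equiv 3,9\pmod{12}$ and $\pi_{G_0,G_1}(m)$ is even for all integers $m>2$, then $\mathcal{G}_{G_0,G_1}(k)=2$. In particular, for such $k$, $\mathcal{F}(k)=2$, $\mathcal{L}(k)=2$, and $\mathcal{G}_{G_0,G_1}(k)=2$ whenever $G_1^2-G_0G_1-G_0^2=\pm1$.
   Context: For a positive integer $k$, $\mathcal{G}_{G_0,G_1}(k)$ is the greatest common divisor of all integers $\sum_{i=0}^{k-1}G_{n+i}$, $n\ge1$; $\mathcal{F}(k)$ and $\mathcal{L}(k)$ denote this quantity for the Fibonacci sequence ($G_0=0,G_1=1$) and the Lucas sequence ($G_0=2,G_1=1$). For $m\ge2$, $\pi_{G_0,G_1}(m)$ is the smallest positive integer $r$ with $G_r\equiv G_0$ and $G_{r+1}\equiv G_1 \pmod m$. -}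

module Defs where

open import Data.Nat as ℕ using (ℕ; zero; suc)
open import Data.Integer using (ℤ; +_; _+_; _-_)
open import Data.Integer.Divisibility using (_∣_)
open import Data.Product using (_×_)
open import Relation.Binary.PropositionalEquality using (_≡_)

G : ℤ → ℤ → ℕ → ℤ
G G₀ G₁ zero = G₀
G G₀ G₁ (suc zero) = G₁
G G₀ G₁ (suc (suc n)) = G G₀ G₁ (suc n) + G G₀ G₁ n

-- Fibonacci (G₀ = 0, G₁ = 1) and Lucas (G₀ = 2, G₁ = 1) sequences
-- are G 0 1 and G 2 1.

blockSum : ℤ → ℤ → ℕ → ℕ → ℤ
blockSum G₀ G₁ zero n = + 0
blockSum G₀ G₁ (suc k) n = blockSum G₀ G₁ k n + G G₀ G₁ (n ℕ.+ k)

IsGcdOfSums : ℤ → ℤ → ℕ → ℕ → Set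
IsGcdOfSums G₀ G₁ k d =
  ((n : ℕ) → 1 ℕ.≤ n → + d ∣ blockSum G₀ G₁ k n)
  × ((c : ℤ) → ((n : ℕ) → 1 ℕ.≤ n → c ∣ blockSum G₀ G₁ k n) → c ∣ + d)

_≡_[mod_] : ℤ → ℤ → ℕ → Set
a ≡ b [mod m ] = + m ∣ (a - b)

IsPeriod : ℤ → ℤ → ℕ → ℕ → Set
IsPeriod G₀ G₁ m r =
  (1 ℕ.≤ r)
  × (G G₀ G₁ r ≡ G₀ [mod m ])
  × (G G₀ G₁ (suc r) ≡ G₁ [mod m ])
  × ((s : ℕ) → 1 ℕ.≤ s → G G₀ G₁ s ≡ G₀ [mod m ] → G G₀ G₁ (suc s) ≡ G₁ [mod m ] → r ℕ.≤ s)

-- The block sum Σ_{i<k} G_{n+i} telescopes to G_{n+k+1} - G_{n+1}, so a number divides all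
-- block sums exactly when (G_k, G_{k+1}) ≡ (G_0, G_1) modulo it, i.e. when k is a multiple of
-- the period modulo that number.  Modulo 2 the period is 3, which divides k.  Modulo any m > 2
-- the period is even while k is odd, which excludes every other common divisor.  For the
-- second route, the characteristic G_{n+1}² - G_n G_{n+1} - G_n² changes sign at each step, so
-- a common divisor d satisfies e ≡ -e (mod d) for the initial characteristic e, i.e. d ∣ 2e.
-- This settles e = ±1 (including Fibonacci); for Lucas e = -5 and the prime 5 is excluded
-- because L_k ≢ L_0 (mod 5).
module Submission where

open import Defs
open import Data.Nat as ℕ using (ℕ; _%_; _>_; zero; suc; s≤s; z≤n)
open import Data.Nat.Divisibility using (_∣_; divides; _∣?_; _∣0; ∣-trans; 0∣⇒≡0; n∣m*n; m%n≡0⇒n∣m; n∣m⇒m%n≡0)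
open import Data.Integer using (ℤ; +_; -_; _*_; _-_; _+_; ∣_∣)
open import Data.Integer.Divisibility using () renaming (_∣_ to _∣ℤ_)
open import Data.Integer.GCD using (gcd)
open import Data.Product using (_×_; ∃; _,_; proj₁; proj₂)
open import Data.Sum using (_⊎_; inj₁; inj₂)
import Data.Sum as Sum
open import Function using (id; _∘_)
open import Relation.Binary.PropositionalEquality using (_≡_; refl; sym; trans; cong; subst; module ≡-Reasoning)

import Data.Nat.Properties as ℕ
import Data.Integer.Properties as ℤ
import Data.Integer.Divisibility.Signed as Signed
open import Data.Nat.DivMod using (m≡m%n+[m/n]*n; m%n<n; m∣n⇒o%n%m≡o%m)
open import Data.Nat.Coprimality using (Coprime; coprime-divisor)
open import Data.Nat.Primality using (Prime; prime?; prime⇒irreducible)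
open import Data.Integer.Tactic.RingSolver using (solve-∀)
import Data.Nat.Tactic.RingSolver as ℕ-Solver
open import Relation.Nullary using (¬_; contradiction)
open import Relation.Nullary.Decidable using (from-yes; from-no)

variable
  a b c d : ℤ
  k m r s : ℕ

-- Defs' `a ≡ b [mod m ]` unfolds to a divisibility of `a - b`, from which Agda cannot recover
-- `a` and `b`; this record wrapper keeps them inferable.
record _≡_⟨mod_⟩ (a b : ℤ) (m : ℕ) : Set where
  constructor mk
  field
    divides-difference : + m Signed.∣ (a - b)

open _≡_⟨mod_⟩

infix 4 _≡_⟨mod_⟩

module _ {m : ℕ} where

  [mod]⇒⟨mod⟩ : a ≡ b [mod m ] → a ≡ b ⟨mod m ⟩
  [mod]⇒⟨mod⟩ p = mk (Signed.∣ᵤ⇒∣ p)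

  ⟨mod⟩⇒[mod] : a ≡ b ⟨mod m ⟩ → a ≡ b [mod m ]
  ⟨mod⟩⇒[mod] p = Signed.∣⇒∣ᵤ (divides-difference p)

  ⟨mod⟩-intro : ∀ q → a - b ≡ q * + m → a ≡ b ⟨mod m ⟩
  ⟨mod⟩-intro q eq = mk (Signed.divides q eq)

  private
    mkBy : ∀ {x} → x ≡ a - b → + m Signed.∣ x → a ≡ b ⟨mod m ⟩
    mkBy eq p = mk (subst (+ m Signed.∣_) eq p)

  ⟨mod⟩-refl : a ≡ a ⟨mod m ⟩
  ⟨mod⟩-refl {a} = ⟨mod⟩-intro (+ 0) (trans (ℤ.+-inverseʳ a) (sym (ℤ.*-zeroˡ (+ m))))

  ⟨mod⟩-sym : a ≡ b ⟨mod m ⟩ → b ≡ a ⟨mod m ⟩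
  ⟨mod⟩-sym {a} {b} (mk p) = mkBy (lemma a b) (Signed.∣m⇒∣-m p)
    where
    lemma : ∀ x y → - (x - y) ≡ y - x
    lemma = solve-∀

  ⟨mod⟩-trans : a ≡ b ⟨mod m ⟩ → b ≡ c ⟨mod m ⟩ → a ≡ c ⟨mod m ⟩
  ⟨mod⟩-trans {a} {b} {c} (mk p) (mk q) = mkBy (lemma a b c) (Signed.∣m∣n⇒∣m+n p q)
    where
    lemma : ∀ x y z → (x - y) + (y - z) ≡ x - z
    lemma = solve-∀

  +-cong⟨mod⟩ : a ≡ b ⟨mod m ⟩ → c ≡ d ⟨mod m ⟩ → a + c ≡ b + d ⟨mod m ⟩
  +-cong⟨mod⟩ {a} {b} {c} {d} (mk p) (mk q) = mkBy (lemma a b c d) (Signed.∣m∣n⇒∣m+n p q)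
    where
    lemma : ∀ x y z w → (x - y) + (z - w) ≡ (x + z) - (y + w)
    lemma = solve-∀

  minus-cong⟨mod⟩ : a ≡ b ⟨mod m ⟩ → c ≡ d ⟨mod m ⟩ → a - c ≡ b - d ⟨mod m ⟩
  minus-cong⟨mod⟩ {a} {b} {c} {d} (mk p) (mk q) = mkBy (lemma a b c d) (Signed.∣m∣n⇒∣m-n p q)
    where
    lemma : ∀ x y z w → (x - y) - (z - w) ≡ (x - z) - (y - w)
    lemma = solve-∀

  *-cong⟨mod⟩ : a ≡ b ⟨mod m ⟩ → c ≡ d ⟨mod m ⟩ → a * c ≡ b * d ⟨mod m ⟩
  *-cong⟨mod⟩ {a} {b} {c} {d} (mk p) (mk q) =
    mkBy (lemma a b c d) (Signed.∣m∣n⇒∣m+n (Signed.∣n⇒∣m*n a q) (Signed.∣m⇒∣m*n d p))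
    where
    lemma : ∀ x y z w → x * (z - w) + (x - y) * w ≡ x * z - y * w
    lemma = solve-∀

  +-cancelˡ⟨mod⟩ : a + c ≡ b + d ⟨mod m ⟩ → a ≡ b ⟨mod m ⟩ → c ≡ d ⟨mod m ⟩
  +-cancelˡ⟨mod⟩ {a} {c} {b} {d} (mk p) (mk q) = mkBy (lemma a b c d) (Signed.∣m∣n⇒∣m-n p q)
    where
    lemma : ∀ x y z w → ((x + z) - (y + w)) - (x - y) ≡ z - w
    lemma = solve-∀

%-of-divisor : ∀ d n k {x} .{{_ : ℕ.NonZero d}} .{{_ : ℕ.NonZero n}} →
               d ∣ n → k % n ≡ x → k % d ≡ x % d
%-of-divisor d n k d∣n k%n≡x = trans (sym (m∣n⇒o%n%m≡o%m d n k d∣n)) (cong (_% d) k%n≡x)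

prime∤⇒coprime : ∀ {p n} → Prime p → ¬ p ∣ n → Coprime n p
prime∤⇒coprime p-prime p∤n (d∣n , d∣p) with prime⇒irreducible p-prime d∣p
... | inj₁ d≡1 = d≡1
... | inj₂ refl = contradiction d∣n p∤n

Periodic : ℤ → ℤ → ℕ → ℕ → Set
Periodic G₀ G₁ m r = ∀ j → G G₀ G₁ (j ℕ.+ r) ≡ G G₀ G₁ j ⟨mod m ⟩

DividesBlockSums : ℤ → ℤ → ℕ → ℤ → Set
DividesBlockSums G₀ G₁ k c = (n : ℕ) → 1 ℕ.≤ n → c ∣ℤ blockSum G₀ G₁ k n

characteristic : ℤ → ℤ → ℕ → ℤ
characteristic G₀ G₁ n =
  G G₀ G₁ (suc n) * G G₀ G₁ (suc n) - G G₀ G₁ n * G G₀ G₁ (suc n) - G G₀ G₁ n * G G₀ G₁ n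

module Sequence (G₀ G₁ : ℤ) where

  private
    g : ℕ → ℤ
    g = G G₀ G₁

    χ : ℕ → ℤ
    χ = characteristic G₀ G₁

  blockSum-telescopes : ∀ k n → blockSum G₀ G₁ k n ≡ g (suc n ℕ.+ k) - g (suc n)
  blockSum-telescopes zero n = begin
    + 0                          ≡⟨ ℤ.+-inverseʳ (g (suc n)) ⟨
    g (suc n) - g (suc n)        ≡⟨ cong (λ i → g (suc i) - g (suc n)) (ℕ.+-identityʳ n) ⟨
    g (suc n ℕ.+ 0) - g (suc n)  ∎
    where open ≡-Reasoning
  blockSum-telescopes (suc k) n = begin
    blockSum G₀ G₁ k n + g (n ℕ.+ k)               ≡⟨ cong (_+ g (n ℕ.+ k)) (blockSum-telescopes k n) ⟩
    (g (suc n ℕ.+ k) - g (suc n)) + g (n ℕ.+ k)    ≡⟨ lemma (g (suc n ℕ.+ k)) (g (suc n)) (g (n ℕ.+ k)) ⟩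
    (g (suc (n ℕ.+ k)) + g (n ℕ.+ k)) - g (suc n)  ≡⟨ cong (λ i → g (suc i) - g (suc n)) (ℕ.+-suc n k) ⟨
    g (suc n ℕ.+ suc k) - g (suc n)                ∎
    where
    open ≡-Reasoning
    lemma : ∀ x y z → (x - y) + z ≡ (x + z) - y
    lemma = solve-∀

  returns⇒periodic : g r ≡ G₀ ⟨mod m ⟩ → g (suc r) ≡ G₁ ⟨mod m ⟩ → Periodic G₀ G₁ m r
  returns⇒periodic {r} {m} r-returns r+1-returns j = proj₁ (shifts j)
    where
    shifts : ∀ j → g (j ℕ.+ r) ≡ g j ⟨mod m ⟩ × g (suc j ℕ.+ r) ≡ g (suc j) ⟨mod m ⟩
    shifts zero = r-returns , r+1-returns
    shifts (suc j) = proj₂ (shifts j) , +-cong⟨mod⟩ (proj₂ (shifts j)) (proj₁ (shifts j))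

  periodic-multiple : Periodic G₀ G₁ m r → r ∣ s → Periodic G₀ G₁ m s
  periodic-multiple {m} {r} periodic (divides q refl) = multiples q
    where
    reassoc : ∀ j q r → (j ℕ.+ q ℕ.* r) ℕ.+ r ≡ j ℕ.+ (r ℕ.+ q ℕ.* r)
    reassoc = ℕ-Solver.solve-∀
    multiples : ∀ q → Periodic G₀ G₁ m (q ℕ.* r)
    multiples zero j = subst (λ i → g i ≡ g j ⟨mod m ⟩) (sym (ℕ.+-identityʳ j)) ⟨mod⟩-refl
    multiples (suc q) j = ⟨mod⟩-trans
      (subst (λ i → g i ≡ g (j ℕ.+ q ℕ.* r) ⟨mod m ⟩) (reassoc j q r) (periodic (j ℕ.+ q ℕ.* r)))
      (multiples q j)

  periodic-remainder : Periodic G₀ G₁ m r → .{{_ : ℕ.NonZero r}} →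
                       ∀ j n → g (j ℕ.+ n) ≡ g (j ℕ.+ n % r) ⟨mod m ⟩
  periodic-remainder {m} {r} periodic j n =
    subst (λ i → g i ≡ g (j ℕ.+ n % r) ⟨mod m ⟩) split
      (periodic-multiple periodic (n∣m*n (n ℕ./ r)) (j ℕ.+ n % r))
    where
    split : (j ℕ.+ n % r) ℕ.+ n ℕ./ r ℕ.* r ≡ j ℕ.+ n
    split = trans (ℕ.+-assoc j _ _) (cong (j ℕ.+_) (sym (m≡m%n+[m/n]*n n r)))

  period-∣ : IsPeriod G₀ G₁ m r → g k ≡ G₀ ⟨mod m ⟩ → g (suc k) ≡ G₁ ⟨mod m ⟩ → r ∣ k
  period-∣ {m} {r@(suc _)} {k} (_ , r-returns , r+1-returns , minimal) k-returns k+1-returns =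
    m%n≡0⇒n∣m k r (remainder≡0 (k % r) (m%n<n k r)
      (⟨mod⟩-trans (⟨mod⟩-sym (periodic-remainder periodic 0 k)) k-returns)
      (⟨mod⟩-trans (⟨mod⟩-sym (periodic-remainder periodic 1 k)) k+1-returns))
    where
    periodic = returns⇒periodic ([mod]⇒⟨mod⟩ r-returns) ([mod]⇒⟨mod⟩ r+1-returns)
    remainder≡0 : ∀ t → t ℕ.< r → g t ≡ G₀ ⟨mod m ⟩ → g (suc t) ≡ G₁ ⟨mod m ⟩ → t ≡ 0
    remainder≡0 zero _ _ _ = refl
    remainder≡0 (suc t) t<r t-returns t+1-returns = contradiction
      (minimal (suc t) (s≤s z≤n) (⟨mod⟩⇒[mod] t-returns) (⟨mod⟩⇒[mod] t+1-returns))
      (ℕ.<⇒≱ t<r)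

  periodic-mod-2 : Periodic G₀ G₁ 2 3
  periodic-mod-2 =
    returns⇒periodic (⟨mod⟩-intro G₁ (lemma₃ G₀ G₁)) (⟨mod⟩-intro (G₁ + G₀) (lemma₄ G₀ G₁))
    where
    lemma₃ : ∀ x y → ((y + x) + y) - x ≡ y * + 2
    lemma₃ = solve-∀
    lemma₄ : ∀ x y → (((y + x) + y) + (y + x)) - y ≡ (y + x) * + 2
    lemma₄ = solve-∀

  characteristic-suc : ∀ n → χ (suc n) ≡ - χ n
  characteristic-suc n = lemma (g (suc n)) (g n)
    where
    lemma : ∀ x y → (x + y) * (x + y) - x * (x + y) - x * x ≡ - (x * x - y * x - y * y)
    lemma = solve-∀

  characteristic-odd : ∀ t → χ (suc (t ℕ.* 2)) ≡ - χ 0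
  characteristic-odd zero = characteristic-suc 0
  characteristic-odd (suc t) = begin
    χ (suc (suc (suc (t ℕ.* 2))))  ≡⟨ characteristic-suc (suc (suc (t ℕ.* 2))) ⟩
    - χ (suc (suc (t ℕ.* 2)))      ≡⟨ cong -_ (characteristic-suc (suc (t ℕ.* 2))) ⟩
    - - χ (suc (t ℕ.* 2))          ≡⟨ ℤ.neg-involutive _ ⟩
    χ (suc (t ℕ.* 2))              ≡⟨ characteristic-odd t ⟩
    - χ 0                          ∎
    where open ≡-Reasoning

  characteristic-cong : ∀ i j → g i ≡ g j ⟨mod m ⟩ → g (suc i) ≡ g (suc j) ⟨mod m ⟩ →
                        χ i ≡ χ j ⟨mod m ⟩
  characteristic-cong _ _ p q = minus-cong⟨mod⟩
    (minus-cong⟨mod⟩ (*-cong⟨mod⟩ q q) (*-cong⟨mod⟩ p q))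
    (*-cong⟨mod⟩ p p)

module BlockSums (G₀ G₁ : ℤ) (k : ℕ) where

  open Sequence G₀ G₁

  private
    g : ℕ → ℤ
    g = G G₀ G₁

    χ : ℕ → ℤ
    χ = characteristic G₀ G₁

  divides-blockSums⇒shifted : DividesBlockSums G₀ G₁ k (+ m) →
                              ∀ n → 1 ℕ.≤ n → g (suc n ℕ.+ k) ≡ g (suc n) ⟨mod m ⟩
  divides-blockSums⇒shifted {m} m∣sums n 1≤n =
    [mod]⇒⟨mod⟩ (subst (+ m ∣ℤ_) (blockSum-telescopes k n) (m∣sums n 1≤n))

  divides-blockSums⇒returns : DividesBlockSums G₀ G₁ k (+ m) →
                              g k ≡ G₀ ⟨mod m ⟩ × g (suc k) ≡ G₁ ⟨mod m ⟩
  divides-blockSums⇒returns {m} m∣sums = +-cancelˡ⟨mod⟩ (shifted 0) k+1-returns , k+1-returns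
    where
    shifted : ∀ n → g (suc (suc n) ℕ.+ k) ≡ g (suc (suc n)) ⟨mod m ⟩
    shifted n = divides-blockSums⇒shifted m∣sums (suc n) (s≤s z≤n)
    k+1-returns : g (suc k) ≡ G₁ ⟨mod m ⟩
    k+1-returns = +-cancelˡ⟨mod⟩ (shifted 1) (shifted 0)

  periodic⇒divides-blockSums : Periodic G₀ G₁ m k → DividesBlockSums G₀ G₁ k (+ m)
  periodic⇒divides-blockSums {m} periodic n _ =
    subst (+ m ∣ℤ_) (sym (blockSum-telescopes k n)) (⟨mod⟩⇒[mod] (periodic (suc n)))

  2∣blockSums : 3 ∣ k → DividesBlockSums G₀ G₁ k (+ 2)
  2∣blockSums 3∣k = periodic⇒divides-blockSums (periodic-multiple periodic-mod-2 3∣k)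

  divides-blockSums⇒∣2χ : k % 2 ≡ 1 → DividesBlockSums G₀ G₁ k (+ m) → + m ∣ℤ + 2 * χ 0
  divides-blockSums⇒∣2χ {m} k-odd m∣sums =
    subst (m ∣_) (trans (cong ∣_∣ (lemma (χ 0))) (ℤ.∣-i∣≡∣i∣ (+ 2 * χ 0)))
      (⟨mod⟩⇒[mod] (subst (λ x → x ≡ χ 0 ⟨mod m ⟩) χk≡-χ0
        (characteristic-cong k 0 k-returns k+1-returns)))
    where
    k-returns = proj₁ (divides-blockSums⇒returns m∣sums)
    k+1-returns = proj₂ (divides-blockSums⇒returns m∣sums)
    χk≡-χ0 : χ k ≡ - χ 0
    χk≡-χ0 = trans (cong χ (trans (m≡m%n+[m/n]*n k 2) (cong (ℕ._+ k ℕ./ 2 ℕ.* 2) k-odd)))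
                   (characteristic-odd (k ℕ./ 2))
    lemma : ∀ x → - x - x ≡ - (+ 2 * x)
    lemma = solve-∀

  no-divisor>2 : k % 2 ≡ 1 → (∀ m → m > 2 → ∃ λ r → IsPeriod G₀ G₁ m r × 2 ∣ r) →
                 ∀ m → m > 2 → ¬ DividesBlockSums G₀ G₁ k (+ m)
  no-divisor>2 k-odd even-periods m m>2 m∣sums
    with r , period , 2∣r ← even-periods m m>2
    with returns ← divides-blockSums⇒returns m∣sums =
    contradiction (trans (sym k%2≡0) k-odd) λ ()
    where
    k%2≡0 = n∣m⇒m%n≡0 k 2 (∣-trans 2∣r (period-∣ period (proj₁ returns) (proj₂ returns)))

  no-divisor>2⇒∣2 : (∀ m → m > 2 → ¬ DividesBlockSums G₀ G₁ k (+ m)) →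
                       DividesBlockSums G₀ G₁ k (+ m) → m ∣ 2
  no-divisor>2⇒∣2 {m = 0} none m∣sums = contradiction
    (λ n 1≤n → subst (3 ∣_) (sym (0∣⇒≡0 (m∣sums n 1≤n))) (3 ∣0))
    (none 3 (s≤s (s≤s (s≤s z≤n))))
  no-divisor>2⇒∣2 {m = 1} _ _ = divides 2 refl
  no-divisor>2⇒∣2 {m = 2} _ _ = divides 1 refl
  no-divisor>2⇒∣2 {m = suc (suc (suc _))} none m∣sums =
    contradiction m∣sums (none _ (s≤s (s≤s (s≤s z≤n))))

  isGcdOfSums-2 : 3 ∣ k → (∀ m → DividesBlockSums G₀ G₁ k (+ m) → m ∣ 2) → IsGcdOfSums G₀ G₁ k 2
  isGcdOfSums-2 3∣k divisors∣2 = 2∣blockSums 3∣k , λ c → divisors∣2 ∣ c ∣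

  gcd-of-even-periods : 3 ∣ k → k % 2 ≡ 1 → (∀ m → m > 2 → ∃ λ r → IsPeriod G₀ G₁ m r × 2 ∣ r) →
                        IsGcdOfSums G₀ G₁ k 2
  gcd-of-even-periods 3∣k k-odd even-periods =
    isGcdOfSums-2 3∣k (λ _ → no-divisor>2⇒∣2 (no-divisor>2 k-odd even-periods))

  gcd-of-unit-characteristic : 3 ∣ k → k % 2 ≡ 1 → χ 0 ≡ + 1 ⊎ χ 0 ≡ - + 1 → IsGcdOfSums G₀ G₁ k 2
  gcd-of-unit-characteristic 3∣k k-odd χ0≡±1 = isGcdOfSums-2 3∣k divisor∣2
    where
    divisor∣2 : ∀ m → DividesBlockSums G₀ G₁ k (+ m) → m ∣ 2
    divisor∣2 m m∣sums = Sum.[ via , via ] χ0≡±1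
      where
      via : ∀ {u} → χ 0 ≡ u → + m ∣ℤ + 2 * u
      via χ0≡u = subst (λ x → + m ∣ℤ + 2 * x) χ0≡u (divides-blockSums⇒∣2χ k-odd m∣sums)

%12∈3,9⇒%d∈3,9 : ∀ k → k % 12 ≡ 3 ⊎ k % 12 ≡ 9 → ∀ d .{{_ : ℕ.NonZero d}} → d ∣ 12 →
                 k % d ≡ 3 % d ⊎ k % d ≡ 9 % d
%12∈3,9⇒%d∈3,9 k k≡3,9 d d∣12 = Sum.map (%-of-divisor d 12 k d∣12) (%-of-divisor d 12 k d∣12) k≡3,9

%12∈3,9⇒3∣ : ∀ k → k % 12 ≡ 3 ⊎ k % 12 ≡ 9 → 3 ∣ k
%12∈3,9⇒3∣ k k≡3,9 = m%n≡0⇒n∣m k 3 (Sum.[ id , id ] (%12∈3,9⇒%d∈3,9 k k≡3,9 3 (divides 4 refl)))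

%12∈3,9⇒odd : ∀ k → k % 12 ≡ 3 ⊎ k % 12 ≡ 9 → k % 2 ≡ 1
%12∈3,9⇒odd k k≡3,9 = Sum.[ id , id ] (%12∈3,9⇒%d∈3,9 k k≡3,9 2 (divides 6 refl))

lucas-periodic-mod-5 : Periodic (+ 2) (+ 1) 5 4
lucas-periodic-mod-5 =
  Sequence.returns⇒periodic (+ 2) (+ 1) (⟨mod⟩-intro (+ 1) refl) (⟨mod⟩-intro (+ 2) refl)

module LucasBlockSums (k : ℕ) (k≡3,9 : k % 12 ≡ 3 ⊎ k % 12 ≡ 9) where

  open Sequence (+ 2) (+ 1)
  open BlockSums (+ 2) (+ 1) k

  5∤divisor : DividesBlockSums (+ 2) (+ 1) k (+ m) → ¬ 5 ∣ m
  5∤divisor m∣sums 5∣m = not-returned (%12∈3,9⇒%d∈3,9 k k≡3,9 4 (divides 3 refl))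
    (⟨mod⟩-trans (⟨mod⟩-sym (periodic-remainder lucas-periodic-mod-5 0 k))
      (proj₁ (divides-blockSums⇒returns 5∣sums)))
    where
    5∣sums : DividesBlockSums (+ 2) (+ 1) k (+ 5)
    5∣sums n 1≤n = ∣-trans 5∣m (m∣sums n 1≤n)
    L : ℕ → ℤ
    L = G (+ 2) (+ 1)
    not-returned : k % 4 ≡ 3 ⊎ k % 4 ≡ 1 → ¬ (L (k % 4) ≡ + 2 ⟨mod 5 ⟩)
    not-returned (inj₁ e) = from-no (5 ∣? 2) ∘ ⟨mod⟩⇒[mod] ∘ subst (λ i → L i ≡ + 2 ⟨mod 5 ⟩) e
    not-returned (inj₂ e) = from-no (5 ∣? 1) ∘ ⟨mod⟩⇒[mod] ∘ subst (λ i → L i ≡ + 2 ⟨mod 5 ⟩) e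

  -- The Lucas characteristic is -5, so `+ m ∣ℤ + 2 * χ 0` computes to `m ∣ 5 * 2`.
  lucas-gcd : IsGcdOfSums (+ 2) (+ 1) k 2
  lucas-gcd = isGcdOfSums-2 (%12∈3,9⇒3∣ k k≡3,9) λ m m∣sums → coprime-divisor {o = 2}
    (prime∤⇒coprime (from-yes (prime? 5)) (5∤divisor m∣sums))
    (divides-blockSums⇒∣2χ (%12∈3,9⇒odd k k≡3,9) m∣sums)

theorem5p5 : (k : ℕ) → 1 ℕ.≤ k → (k % 12 ≡ 3 ⊎ k % 12 ≡ 9) →
    ((G₀ G₁ : ℤ) → gcd G₀ G₁ ≡ + 1 →
      ((m : ℕ) → m > 2 → ∃ λ r → IsPeriod G₀ G₁ m r × 2 ∣ r) →
      IsGcdOfSums G₀ G₁ k 2)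
    × IsGcdOfSums (+ 0) (+ 1) k 2
    × IsGcdOfSums (+ 2) (+ 1) k 2
    × ((G₀ G₁ : ℤ) →
      (G₁ * G₁ - G₀ * G₁ - G₀ * G₀ ≡ + 1 ⊎ G₁ * G₁ - G₀ * G₁ - G₀ * G₀ ≡ - (+ 1)) →
      IsGcdOfSums G₀ G₁ k 2)
theorem5p5 k _ k≡3,9 =
  (λ G₀ G₁ _ → BlockSums.gcd-of-even-periods G₀ G₁ k 3∣k k-odd)
  , BlockSums.gcd-of-unit-characteristic (+ 0) (+ 1) k 3∣k k-odd (inj₁ refl)
  , LucasBlockSums.lucas-gcd k k≡3,9
  , λ G₀ G₁ → BlockSums.gcd-of-unit-characteristic G₀ G₁ k 3∣k k-odd
  where
  3∣k = %12∈3,9⇒3∣ k k≡3,9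
  k-odd = %12∈3,9⇒odd k k≡3,9
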